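{- For integers $m\geq 0$ and $n>0$, the lattice $\mathbf{W}(m,n)$ contains a chain of length $(m+1)n-1$ (i.e. a chain with $(m+1)n$ elements).
   Context: An $(m,n)$-word is a word $\mathfrak{w}=w_1w_2\cdots w_n$ of length $n$ over the alphabet $\{0,1,\dots,m+1\}$ such that (MN1) $w_1\neq m+1$, and (MN2) for every $s$ with $1\le s\le m$ and every index $i$, if $w_i=s$ then $w_j\ge s$ for all $j<i$. $\mathbf{W}(m,n)$ is the set of $(m,n)$-words ordered componentwise ($\mathfrak{u}\le\mathfrak{v}$ iff $u_i\le v_i$ for all $i$). The length of a chain is one less than its number of elements. -}

module Defs where

open import Data.Nat using (ℕ; suc; _≤_; _≥_; _<_)
open import Data.Fin using (Fin; toℕ) renaming (_<_ to _<ᶠ_)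
open import Data.Product using (_×_; ∃)
open import Relation.Binary.PropositionalEquality using (_≡_)
open import Relation.Nullary using (¬_)

-- A word of length n over ℕ, positions indexed by Fin n (position i ↔ w_{i+1}).
Word : ℕ → Set
Word n = Fin n → ℕ

record IsMNWord (m n : ℕ) (w : Word n) : Set where
  field
    alphabet : ∀ i → w i ≤ suc m
    mn1      : ∀ i → toℕ i ≡ 0 → ¬ (w i ≡ suc m)
    mn2      : ∀ s → 1 ≤ s → s ≤ m → ∀ i → w i ≡ s → ∀ j → j <ᶠ i → w j ≥ s

_≤ʷ_ : ∀ {n} → Word n → Word n → Set
u ≤ʷ v = ∀ i → u i ≤ v i

_<ʷ_ : ∀ {n} → Word n → Word n → Set
u <ʷ v = u ≤ʷ v × ∃ (λ i → ¬ (u i ≡ v i))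

-- A chain in W(m,n) with k elements, listed in increasing order:
-- k elements of W(m,n), strictly increasing (hence distinct and pairwise comparable).
record ChainIn (m n k : ℕ) : Set where
  field
    elem       : Fin k → Word n
    isWord     : ∀ a → IsMNWord m n (elem a)
    increasing : ∀ a b → a <ᶠ b → elem a <ʷ elem b

-- The k-th word of the chain, 0 ≤ k < (m+1)n, is the sum of a staircase and a bump.
-- While k ≤ mn the staircase fills positions left to right, each up to m, one unit
-- per step, so position i holds min(m, k − mi); the word stays non-increasing, which
-- gives (MN2). Once the staircase is full (k = mn), the letters at positions
-- 1, …, n−1 are raised one at a time to m+1, which (MN2) does not constrain and
-- (MN1) allows away from the first position. Every step raises one letter by one,
-- so the (m+1)n words form a chain.
module Submission where

open import Defs
open import Data.Nat using (ℕ; zero; suc; _+_; _*_; _∸_; _⊓_; _≤_; _<_; _≥_; z≤n; s≤s; _≤?_; _<?_)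
open import Data.Nat.Properties
open import Data.Nat.DivMod using (_/_; _%_; m≡m%n+[m/n]*n; m%n<n; m/n*n≤m; m<n*o⇒m/o<n)
open import Data.Fin using (Fin; toℕ; fromℕ<)
open import Data.Fin.Properties using (toℕ<n; toℕ-fromℕ<)
open import Data.Product using (_×_; _,_; ∃)
open import Data.Sum using (_⊎_; inj₁; inj₂)
open import Data.Empty using (⊥-elim)
open import Relation.Nullary using (¬_; yes; no)
open import Relation.Binary.PropositionalEquality using (_≡_; refl; sym; subst; subst₂; cong)

chainFromSteps : ∀ {m n K} (w : ℕ → Word n) →
                 (∀ k → IsMNWord m n (w k)) →
                 (∀ {k k′} → k ≤ k′ → w k ≤ʷ w k′) →
                 (∀ k → suc k < K → ∃ λ i → w k i < w (suc k) i) →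
                 ChainIn m n K
chainFromSteps {K = K} w isWord mono step = record
  { elem       = λ a → w (toℕ a)
  ; isWord     = λ a → isWord (toℕ a)
  ; increasing = increasing
  }
  where
  increasing : ∀ (a b : Fin K) → toℕ a < toℕ b → w (toℕ a) <ʷ w (toℕ b)
  increasing a b a<b with step (toℕ a) (≤-<-trans a<b (toℕ<n b))
  ... | i , lt = mono (<⇒≤ a<b) , i , <⇒≢ (<-≤-trans lt (mono a<b i))

staircase : ℕ → ℕ → ℕ → ℕ
staircase m k i = m ⊓ (k ∸ m * i)

staircase≤m : ∀ m k i → staircase m k i ≤ m
staircase≤m m k i = m⊓n≤m m (k ∸ m * i)

staircase-monoˡ : ∀ m {k k′} i → k ≤ k′ → staircase m k i ≤ staircase m k′ i
staircase-monoˡ m i k≤k′ = ⊓-monoʳ-≤ m (∸-monoˡ-≤ (m * i) k≤k′)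

staircase-antitoneʳ : ∀ m k {i j} → j ≤ i → staircase m k i ≤ staircase m k j
staircase-antitoneʳ m k j≤i = ⊓-monoʳ-≤ m (∸-monoʳ-≤ k (*-monoʳ-≤ m j≤i))

staircase-full : ∀ m k i → m * suc i ≤ k → staircase m k i ≡ m
staircase-full m k i le =
  m≤n⇒m⊓n≡m (m+n≤o⇒m≤o∸n m (subst (_≤ k) (*-suc m i) le))

staircase-step : ∀ m k i → m * i ≤ k → k < m * suc i →
                 staircase m k i < staircase m (suc k) i
staircase-step m k i mi≤k k<m[1+i] = begin-strict
  m ⊓ (k ∸ m * i)        ≡⟨ m≥n⇒m⊓n≡n (<⇒≤ r<m) ⟩
  k ∸ m * i              <⟨ n<1+n (k ∸ m * i) ⟩
  suc (k ∸ m * i)        ≡⟨ sym (m≥n⇒m⊓n≡n r<m) ⟩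
  m ⊓ suc (k ∸ m * i)    ≡⟨ cong (m ⊓_) (sym (+-∸-assoc 1 mi≤k)) ⟩
  m ⊓ (suc k ∸ m * i)    ∎
  where
  open ≤-Reasoning
  r<m : k ∸ m * i < m
  r<m = +-cancelʳ-< (m * i) (k ∸ m * i) m (begin-strict
    k ∸ m * i + m * i   ≡⟨ m∸n+n≡m mi≤k ⟩
    k                   <⟨ k<m[1+i] ⟩
    m * suc i           ≡⟨ *-suc m i ⟩
    m + m * i           ∎)

-- The position being filled at step k is the quotient ⌊k / m⌋.
staircase-position : ∀ m n k → k < m * n → ∃ λ i → i < n × m * i ≤ k × k < m * suc i
staircase-position zero n k ()
staircase-position m@(suc _) n k k<mn =
  k / m , m<n*o⇒m/o<n (subst (k <_) (*-comm m n) k<mn)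
        , subst (_≤ k) (*-comm (k / m) m) (m/n*n≤m k m)
        , k<m[1+k/m]
  where
  open ≤-Reasoning
  k<m[1+k/m] : k < m * suc (k / m)
  k<m[1+k/m] = begin-strict
    k                    ≡⟨ m≡m%n+[m/n]*n k m ⟩
    k % m + k / m * m    <⟨ +-monoˡ-< (k / m * m) (m%n<n k m) ⟩
    m + k / m * m        ≡⟨ *-comm (suc (k / m)) m ⟩
    m * suc (k / m)      ∎

bump : ℕ → ℕ → ℕ → ℕ
bump N k zero = 0
bump N k (suc i) with N + suc i ≤? k
... | yes _ = 1
... | no _  = 0

bump-cases : ∀ N k i → bump N k i ≡ 0 ⊎ (bump N k i ≡ 1 × N + i ≤ k)
bump-cases N k zero = inj₁ refl
bump-cases N k (suc i) with N + suc i ≤? k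
... | yes le = inj₂ (refl , le)
... | no _   = inj₁ refl

bump≤1 : ∀ N k i → bump N k i ≤ 1
bump≤1 N k i with bump-cases N k i
... | inj₁ b≡0       = ≤-trans (≤-reflexive b≡0) z≤n
... | inj₂ (b≡1 , _) = ≤-reflexive b≡1

bump-monoˡ : ∀ N {k k′} i → k ≤ k′ → bump N k i ≤ bump N k′ i
bump-monoˡ N zero k≤k′ = z≤n
bump-monoˡ N {k} {k′} (suc i) k≤k′ with N + suc i ≤? k | N + suc i ≤? k′
... | yes _  | yes _  = ≤-refl
... | yes le | no ¬le = ⊥-elim (¬le (≤-trans le k≤k′))
... | no _   | _      = z≤n

bump-step : ∀ N j → bump N (N + j) (suc j) < bump N (N + suc j) (suc j)
bump-step N j with N + suc j ≤? N + j | N + suc j ≤? N + suc j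
... | yes le | _      = ⊥-elim (<-irrefl refl (+-cancelˡ-≤ N (suc j) j le))
... | no _   | yes _  = n<1+n 0
... | no _   | no ¬le = ⊥-elim (¬le ≤-refl)

column : ℕ → ℕ → ℕ → ℕ → ℕ
column m n k i = staircase m k i + bump (m * n) k i

column-step : ∀ m n k → suc k < suc m * n → ∃ λ i → i < n × column m n k i < column m n (suc k) i
column-step m n k 1+k<[1+m]n with k <? m * n
... | yes k<mn with staircase-position m n k k<mn
...   | i , i<n , mi≤k , k<m[1+i] =
  i , i<n , +-mono-<-≤ (staircase-step m k i mi≤k k<m[1+i]) (bump-monoˡ (m * n) i (n≤1+n k))
column-step m n k 1+k<[1+m]n | no k≮mn with m≤n⇒∃[o]m+o≡n (≮⇒≥ k≮mn)
... | j , refl =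
  suc j , 1+j<n ,
  +-mono-≤-< (staircase-monoˡ m (suc j) (n≤1+n k))
             (subst (λ t → bump N (N + j) (suc j) < bump N t (suc j)) (+-suc N j) (bump-step N j))
  where
  N = m * n
  1+j<n : suc j < n
  1+j<n = +-cancelˡ-< N (suc j) n
            (subst₂ _<_ (sym (+-suc N j)) (+-comm n N) 1+k<[1+m]n)

word : ∀ m n → ℕ → Word n
word m n k i = column m n k (toℕ i)

word-monoˡ : ∀ m n {k k′} → k ≤ k′ → word m n k ≤ʷ word m n k′
word-monoˡ m n k≤k′ i =
  +-mono-≤ (staircase-monoˡ m (toℕ i) k≤k′) (bump-monoˡ (m * n) (toℕ i) k≤k′)

word-step : ∀ m n k → suc k < suc m * n → ∃ λ i → word m n k i < word m n (suc k) i
word-step m n k 1+k<[1+m]n with column-step m n k 1+k<[1+m]n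
... | i , i<n , lt =
  fromℕ< i<n , subst (λ t → column m n k t < column m n (suc k) t) (sym (toℕ-fromℕ< i<n)) lt

-- A raised letter sits on a full column of the staircase, so it equals m + 1.
word-bumped : ∀ m n k (i : Fin n) → bump (m * n) k (toℕ i) ≡ 1 → m * n + toℕ i ≤ k →
              word m n k i ≡ m + 1
word-bumped m n k i b≡1 le rewrite b≡1 =
  cong (_+ 1) (staircase-full m k (toℕ i) (≤-trans (*-monoʳ-≤ m (toℕ<n i))
                                                    (≤-trans (m≤m+n (m * n) (toℕ i)) le)))

word-isMNWord : ∀ m n k → IsMNWord m n (word m n k)
word-isMNWord m n k = record { alphabet = alphabet ; mn1 = mn1 ; mn2 = mn2 }
  where
  m+1≡1+m : m + 1 ≡ suc m
  m+1≡1+m = +-comm m 1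

  alphabet : ∀ i → word m n k i ≤ suc m
  alphabet i = subst (word m n k i ≤_) m+1≡1+m
    (+-mono-≤ (staircase≤m m k (toℕ i)) (bump≤1 (m * n) k (toℕ i)))

  mn1 : ∀ i → toℕ i ≡ 0 → ¬ (word m n k i ≡ suc m)
  mn1 i i≡0 w≡1+m rewrite i≡0 | +-identityʳ (staircase m k 0) =
    <-irrefl w≡1+m (s≤s (staircase≤m m k 0))

  mn2 : ∀ s → 1 ≤ s → s ≤ m → ∀ i → word m n k i ≡ s →
        ∀ j → toℕ j < toℕ i → word m n k j ≥ s
  mn2 s _ s≤m i w≡s j j<i with bump-cases (m * n) k (toℕ i)
  ... | inj₁ b≡0 = begin
    s                            ≡⟨ sym w≡s ⟩
    word m n k i                 ≡⟨ cong (staircase m k (toℕ i) +_) b≡0 ⟩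
    staircase m k (toℕ i) + 0    ≡⟨ +-identityʳ _ ⟩
    staircase m k (toℕ i)        ≤⟨ staircase-antitoneʳ m k (<⇒≤ j<i) ⟩
    staircase m k (toℕ j)        ≤⟨ m≤m+n _ _ ⟩
    word m n k j                 ∎
    where open ≤-Reasoning
  ... | inj₂ (b≡1 , le) = ⊥-elim (<-irrefl refl (begin-strict
    m              <⟨ n<1+n m ⟩
    suc m          ≡⟨ sym m+1≡1+m ⟩
    m + 1          ≡⟨ sym (word-bumped m n k i b≡1 le) ⟩
    word m n k i   ≡⟨ w≡s ⟩
    s              ≤⟨ s≤m ⟩
    m              ∎))
    where open ≤-Reasoning

lemma4p6 : (m n : ℕ) → 0 < n → ChainIn m n (suc m * n)
lemma4p6 m n _ = chainFromSteps (word m n) (word-isMNWord m n) (word-monoˡ m n) (word-step m n)
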